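{- For every $n \ge 1$, the competitive ratio of any deterministic online algorithm for the online multiple knapsack problem with $n$ bins is at most $R = 1/(1+\ln 2)$.
   Context: Online multiple knapsack problem (proportional variant): there are $n$ bins, each of capacity $1$. Items with sizes in $(0,1]$ arrive one at a time. Upon arrival of an item, an online algorithm must irrevocably either reject it or place it into one bin so that no bin's total size exceeds $1$, without knowledge of future items. $A(\sigma)$ is the total size of the items accepted by algorithm $A$ on input $\sigma$; $\mathrm{OPT}(\sigma)$ is the maximum total size of a subset of items of $\sigma$ that can be feasibly packed into the $n$ bins. An algorithm is $\alpha$-competitive if $A(\sigma)\ge \alpha\cdot\mathrm{OPT}(\sigma)$ for every input $\sigma$; its competitive ratio is the supremum of such $\alpha$.
   Formalization: The values α for which an algorithm is α-competitive range only over the rationals, and the item sizes are taken to be rationals in $(0,1]$. -}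

module Defs where

open import Data.Nat as ℕ using (ℕ; zero; suc)
open import Data.Integer using (+_)
open import Data.Rational using (ℚ; 0ℚ; 1ℚ; _+_; _*_; _/_; _≤_; _<_; _≤ᵇ_)
open import Data.Fin using (Fin; _≟_)
open import Data.Maybe using (Maybe; just; nothing)
open import Data.List using (List; []; _∷_; _∷ʳ_; length)
open import Data.List.Relation.Unary.All using (All)
open import Data.Vec using (Vec; []; _∷_)
open import Data.Bool using (if_then_else_)
open import Data.Product using (_×_)
open import Relation.Nullary.Decidable using (does)

-- Partial sums of ln 2 = Σ_{k≥1} 1 / (k · 2^k):  lnTwoApprox N = Σ_{k=1}^{N} 1/(k·2^k).
-- These increase strictly to ln 2, so for α : ℚ,
--   α ≤ 1/(1 + ln 2)  ⇔  ∀ N, α * (1 + lnTwoApprox N) ≤ 1.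
-- q ^ k for rationals
powℚ : ℚ → ℕ → ℚ
powℚ q zero    = 1ℚ
powℚ q (suc k) = q * powℚ q k

lnTwoApprox : ℕ → ℚ
lnTwoApprox zero    = 0ℚ
lnTwoApprox (suc m) = lnTwoApprox m + ((+ 1) / suc m) * powℚ ((+ 1) / 2) (suc m)

ValidInput : List ℚ → Set
ValidInput σ = All (λ x → (0ℚ < x) × (x ≤ 1ℚ)) σ

-- A deterministic online algorithm for n bins: given the items seen so far
-- (in arrival order) and the current item, it either rejects (nothing) or
-- names a bin (just i).  Its past decisions are determined by the past items,
-- so this is the most general deterministic online algorithm.
-- Convention: a placement that would overflow the bin is treated as a rejection
-- (so every such function induces a feasible online algorithm, and every
-- feasible online algorithm arises this way).
Algorithm : ℕ → Set
Algorithm n = List ℚ → ℚ → Maybe (Fin n)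

runFrom : ∀ {n} → Algorithm n → List ℚ → (Fin n → ℚ) → List ℚ → ℚ
runFrom A hist load [] = 0ℚ
runFrom {n} A hist load (x ∷ xs) with A hist x
... | nothing = runFrom A (hist ∷ʳ x) load xs
... | just i  =
  if (load i + x) ≤ᵇ 1ℚ
  then x + runFrom A (hist ∷ʳ x) (λ j → if does (j ≟ i) then load j + x else load j) xs
  else runFrom A (hist ∷ʳ x) load xs

run : ∀ {n} → Algorithm n → List ℚ → ℚ
run A σ = runFrom A [] (λ _ → 0ℚ) σ

Packing : ℕ → List ℚ → Set
Packing n σ = Vec (Maybe (Fin n)) (length σ)

binLoad : ∀ {n} (σ : List ℚ) → Packing n σ → Fin n → ℚ
binLoad [] [] i = 0ℚ
binLoad (x ∷ xs) (nothing ∷ p) i = binLoad xs p i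
binLoad (x ∷ xs) (just j ∷ p) i =
  (if does (j ≟ i) then x else 0ℚ) + binLoad xs p i

packedValue : ∀ {n} (σ : List ℚ) → Packing n σ → ℚ
packedValue [] [] = 0ℚ
packedValue (x ∷ xs) (nothing ∷ p) = packedValue xs p
packedValue (x ∷ xs) (just j ∷ p) = x + packedValue xs p

Feasible : ∀ {n} (σ : List ℚ) → Packing n σ → Set
Feasible σ p = ∀ i → binLoad σ p i ≤ 1ℚ

-- A is α-competitive iff A(σ) ≥ α·OPT(σ) for every input σ; since OPT(σ) is
-- the maximum value of a feasible packing, this says A(σ) ≥ α·value(p)
-- for every feasible packing p of σ.
IsCompetitive : ∀ {n} → ℚ → Algorithm n → Set
IsCompetitive {n} α A =
  ∀ (σ : List ℚ) → ValidInput σ →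
  ∀ (p : Packing n σ) → Feasible σ p → α * packedValue σ p ≤ run A σ

{-# OPTIONS --safe #-}

-- Adversary: n items of size y m, then n of size y (m − 1), …, finally n of size y 0, where
-- ½ < y m ≤ ⋯ ≤ y 0 ≤ 1.  Items larger than ½ never share a bin, so while items of size y j arrive
-- the potential (empty bins) + (accepted volume) / y j stays constant.  Competitiveness after each
-- round (OPT ≥ n · y j) lets the potentials telescope to α (1 + Σ_{j<m} (1 − y (j + 1) / y j)) ≤ 1.
-- For equally spaced sizes y j = 1 − j h the sum is a Riemann sum of ∫_0^½ dt / (1 − t) = ln 2;
-- comparing it increment by increment with the partial sums of − ln (1 − t) = Σ_k t ^ k / k shows
-- that it exceeds lnTwoApprox N once h is small enough.

module Submission where

open import Defs
open import Data.Nat using (ℕ)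
open import Data.Rational using (ℚ; 1ℚ; _+_; _*_; _≤_)
import Data.Nat as N

open import Level using (0ℓ)
open import Function using (_∘_)
open import Data.Nat using (zero; suc)
import Data.Nat.Properties as ℕₚ
import Data.Integer as ℤ
import Data.Integer.Properties as ℤₚ
open import Data.Rational
  using (0ℚ; ½; -_; _-_; _/_; _<_; *<*; _≤ᵇ_; 1/_; ≢-nonZero; nonNegative; positive; ↥_; ↧ₙ_)
open import Data.Rational.Literals using (fromℤ)
open import Data.Rational.Properties hiding (_≟_)
import Data.Rational.Properties as ℚₚ
open import Data.Fin using (Fin; zero; suc; _≟_)
open import Data.Maybe as Maybe using (Maybe; just; nothing)
open import Data.List using (List; []; _∷_; _∷ʳ_; _++_; replicate)
open import Data.List.Properties using (∷ʳ-++; ++-identityʳ)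
open import Data.List.Relation.Unary.All using (All; []; _∷_)
open import Data.List.Relation.Unary.All.Properties using (++⁺; replicate⁺)
open import Data.Vec using (Vec; []; _∷_; count; tabulate; map)
open import Data.Bool using (Bool; true; false; if_then_else_; T)
open import Data.Unit using (tt)
open import Data.Product using (_,_)
open import Data.Sum using (_⊎_; inj₁; inj₂)
open import Data.Empty using (⊥-elim)
open import Relation.Binary.PropositionalEquality
open import Relation.Nullary using (yes; no; does)
open import Relation.Nullary.Decidable using (dec⇒maybe; dec-false)
open import Algebra.Bundles using (CommutativeMonoid)
open import Algebra.Properties.CommutativeSemigroup (CommutativeMonoid.commutativeSemigroup *-1-commutativeMonoid)
  using (x∙yz≈y∙xz; x∙yz≈yx∙z; interchange)
open import Tactic.RingSolver using (solve-∀)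
open import Tactic.RingSolver.Core.AlmostCommutativeRing
  using (AlmostCommutativeRing; fromCommutativeRing)

-- Arithmetic in ℚ

-- The zero test lets the solver drop cancelled monomials such as p - p.
ℚ-ring : AlmostCommutativeRing 0ℓ 0ℓ
ℚ-ring = fromCommutativeRing +-*-commutativeRing (λ p → dec⇒maybe (0ℚ ℚₚ.≟ p))

p≤q⇒0≤q-p : ∀ {p q} → p ≤ q → 0ℚ ≤ q - p
p≤q⇒0≤q-p {p} {q} p≤q = subst (_≤ q - p) (+-inverseʳ p) (+-monoˡ-≤ (- p) p≤q)

0≤q-p⇒p≤q : ∀ {p q} → 0ℚ ≤ q - p → p ≤ q
0≤q-p⇒p≤q {p} {q} 0≤q-p = begin
  p            ≡⟨ sym (+-identityʳ p) ⟩
  p + 0ℚ       ≤⟨ +-monoʳ-≤ p 0≤q-p ⟩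
  p + (q - p)  ≡⟨ p+[q-p]≡q p q ⟩
  q            ∎
  where
  open ≤-Reasoning
  p+[q-p]≡q : ∀ p q → p + (q - p) ≡ q
  p+[q-p]≡q = solve-∀ ℚ-ring

p<q⇒0<q-p : ∀ {p q} → p < q → 0ℚ < q - p
p<q⇒0<q-p {p} {q} p<q = subst (_< q - p) (+-inverseʳ p) (+-monoˡ-< (- p) p<q)

*-monoˡ-≤-0≤ : ∀ {r p q} → 0ℚ ≤ r → p ≤ q → r * p ≤ r * q
*-monoˡ-≤-0≤ {r} 0≤r = *-monoˡ-≤-nonNeg r {{nonNegative 0≤r}}

*-monoʳ-≤-0≤ : ∀ {r p q} → 0ℚ ≤ r → p ≤ q → p * r ≤ q * r
*-monoʳ-≤-0≤ {r} 0≤r = *-monoʳ-≤-nonNeg r {{nonNegative 0≤r}}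

0≤*0≤⇒0≤* : ∀ {p q} → 0ℚ ≤ p → 0ℚ ≤ q → 0ℚ ≤ p * q
0≤*0≤⇒0≤* {p} {q} 0≤p 0≤q = subst (_≤ p * q) (*-zeroˡ q) (*-monoʳ-≤-0≤ 0≤q 0≤p)

[1+p]*q≡q+p*q : ∀ p q → (1ℚ + p) * q ≡ q + p * q
[1+p]*q≡q+p*q = solve-∀ ℚ-ring

0<½ : 0ℚ < ½
0<½ = *<* (ℤ.+<+ (N.s≤s N.z≤n))

½<1 : ½ < 1ℚ
½<1 = *<* (ℤ.+<+ (N.s≤s (N.s≤s N.z≤n)))

¼ : ℚ
¼ = ℤ.+ 1 / 4

fromℕ : ℕ → ℚ
fromℕ zero    = 0ℚ
fromℕ (suc k) = 1ℚ + fromℕ k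

fromℕ-+ : ∀ a b → fromℕ (a N.+ b) ≡ fromℕ a + fromℕ b
fromℕ-+ zero    b = sym (+-identityˡ (fromℕ b))
fromℕ-+ (suc a) b = trans (cong (1ℚ +_) (fromℕ-+ a b)) (sym (+-assoc 1ℚ (fromℕ a) (fromℕ b)))

fromℕ-* : ∀ a b → fromℕ (a N.* b) ≡ fromℕ a * fromℕ b
fromℕ-* zero    b = sym (*-zeroˡ (fromℕ b))
fromℕ-* (suc a) b = begin
  fromℕ (b N.+ a N.* b)         ≡⟨ fromℕ-+ b (a N.* b) ⟩
  fromℕ b + fromℕ (a N.* b)     ≡⟨ cong (fromℕ b +_) (fromℕ-* a b) ⟩
  fromℕ b + fromℕ a * fromℕ b   ≡⟨ sym ([1+p]*q≡q+p*q (fromℕ a) (fromℕ b)) ⟩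
  (1ℚ + fromℕ a) * fromℕ b      ∎
  where open ≡-Reasoning

fromℕ-^ : ∀ a k → fromℕ (a N.^ k) ≡ powℚ (fromℕ a) k
fromℕ-^ a zero    = +-identityʳ 1ℚ
fromℕ-^ a (suc k) = trans (fromℕ-* a (a N.^ k)) (cong (fromℕ a *_) (fromℕ-^ a k))

fromℕ-nonNeg : ∀ k → 0ℚ ≤ fromℕ k
fromℕ-nonNeg zero    = ≤-refl
fromℕ-nonNeg (suc k) = +-mono-≤ (<⇒≤ (positive⁻¹ 1ℚ)) (fromℕ-nonNeg k)

fromℕ-mono-≤ : ∀ {a b} → a N.≤ b → fromℕ a ≤ fromℕ b
fromℕ-mono-≤ {b = b} N.z≤n = fromℕ-nonNeg b
fromℕ-mono-≤ (N.s≤s a≤b)   = +-monoʳ-≤ 1ℚ (fromℕ-mono-≤ a≤b)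

fromℕ-pos : ∀ k → 0ℚ < fromℕ (suc k)
fromℕ-pos k = <-≤-trans (positive⁻¹ 1ℚ) (fromℕ-mono-≤ {1} {suc k} (N.s≤s N.z≤n))

fromℕ≡fromℤ : ∀ k → fromℕ k ≡ fromℤ (ℤ.+ k)
fromℕ≡fromℤ zero    = refl
fromℕ≡fromℤ (suc k) = begin
  1ℚ + fromℕ k                        ≡⟨ cong (1ℚ +_) (fromℕ≡fromℤ k) ⟩
  -- 1ℚ + q unfolds to (↥ 1ℚ ℤ.* ↧ q ℤ.+ ↥ q ℤ.* ↧ 1ℚ) / (↧ₙ 1ℚ ℕ.* ↧ₙ q).
  1ℚ + fromℤ (ℤ.+ k)                  ≡⟨ cong (λ z → (ℤ.+ 1 ℤ.+ z) / 1) (ℤₚ.*-identityʳ (ℤ.+ k)) ⟩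
  ↥ fromℤ (ℤ.+ suc k) / ↧ₙ fromℤ (ℤ.+ suc k) ≡⟨ ↥p/↧p≡p (fromℤ (ℤ.+ suc k)) ⟩
  fromℤ (ℤ.+ suc k)                   ∎
  where open ≡-Reasoning

1/suc : ℕ → ℚ
1/suc k = ℤ.+ 1 / suc k

1/suc*fromℕ-suc : ∀ m → 1/suc m * fromℕ (suc m) ≡ 1ℚ
1/suc*fromℕ-suc m = begin
  1/suc m * fromℕ (suc m)   ≡⟨ cong₂ _*_ (↥p/↧p≡p (1/ p)) (fromℕ≡fromℤ (suc m)) ⟩
  (1/ p) * p                ≡⟨ *-inverseˡ p ⟩
  1ℚ                        ∎
  where
  open ≡-Reasoning
  p = fromℤ (ℤ.+ suc m)

1/suc-nonNeg : ∀ k → 0ℚ ≤ 1/suc k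
1/suc-nonNeg k = nonNegative⁻¹ _ {{normalize-nonNeg 1 (suc k)}}

pos⇒≢0 : ∀ {p} → 0ℚ < p → p ≢ 0ℚ
pos⇒≢0 0<p = ≢-sym (<⇒≢ 0<p)

-- A total reciprocal, with the junk value recip 0ℚ = 0ℚ.
recip : ℚ → ℚ
recip p with p ℚₚ.≟ 0ℚ
... | yes _   = 0ℚ
... | no p≢0 = (1/ p) {{≢-nonZero p≢0}}

*-recip : ∀ {p} → p ≢ 0ℚ → p * recip p ≡ 1ℚ
*-recip {p} p≢0 with p ℚₚ.≟ 0ℚ
... | yes p≡0 = ⊥-elim (p≢0 p≡0)
... | no p≢0′ = *-inverseʳ p {{≢-nonZero p≢0′}}

recip-pos : ∀ {p} → 0ℚ < p → 0ℚ < recip p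
recip-pos {p} 0<p with p ℚₚ.≟ 0ℚ
... | yes p≡0 = ⊥-elim (<-irrefl (sym p≡0) 0<p)
... | no p≢0 = positive⁻¹ _ {{1/pos⇒pos p {{positive 0<p}}}}

recip-antitone : ∀ {p q} → 0ℚ < p → p ≤ q → recip q ≤ recip p
recip-antitone {p} {q} 0<p p≤q = 0≤q-p⇒p≤q (subst (0ℚ ≤_) (sym difference)
  (0≤*0≤⇒0≤* (0≤*0≤⇒0≤* (<⇒≤ (recip-pos 0<p)) (<⇒≤ (recip-pos 0<q))) (p≤q⇒0≤q-p p≤q)))
  where
  0<q = <-≤-trans 0<p p≤q
  inverses : ∀ {p q a b} → p * a ≡ 1ℚ → q * b ≡ 1ℚ → a - b ≡ a * b * (q - p)
  inverses {p} {q} {a} {b} pa≡1 qb≡1 = begin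
    a - b                      ≡⟨ cong₂ _-_ (sym (*-identityʳ a)) (sym (*-identityʳ b)) ⟩
    a * 1ℚ - b * 1ℚ            ≡⟨ cong₂ (λ u v → a * u - b * v) (sym qb≡1) (sym pa≡1) ⟩
    a * (q * b) - b * (p * a)  ≡⟨ regroup p q a b ⟩
    a * b * (q - p)            ∎
    where
    open ≡-Reasoning
    regroup : ∀ p q a b → a * (q * b) - b * (p * a) ≡ a * b * (q - p)
    regroup = solve-∀ ℚ-ring
  difference : recip p - recip q ≡ recip p * recip q * (q - p)
  difference = inverses {p} {q} {recip p} {recip q} (*-recip (pos⇒≢0 0<p)) (*-recip (pos⇒≢0 0<q))

≤-*-recip : ∀ {d x y} → 0ℚ < d → d * x ≤ y → x ≤ y * recip d
≤-*-recip {d} {x} {y} 0<d dx≤y = begin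
  x                    ≡⟨ sym (*-identityʳ x) ⟩
  x * 1ℚ               ≡⟨ cong (x *_) (sym (*-recip (pos⇒≢0 0<d))) ⟩
  x * (d * recip d)    ≡⟨ x∙yz≈yx∙z x d (recip d) ⟩
  d * x * recip d      ≤⟨ *-monoʳ-≤-0≤ (<⇒≤ (recip-pos 0<d)) dx≤y ⟩
  y * recip d          ∎
  where open ≤-Reasoning

powℚ-nonNeg : ∀ {t} k → 0ℚ ≤ t → 0ℚ ≤ powℚ t k
powℚ-nonNeg zero    0≤t = <⇒≤ (positive⁻¹ 1ℚ)
powℚ-nonNeg (suc k) 0≤t = 0≤*0≤⇒0≤* 0≤t (powℚ-nonNeg k 0≤t)

powℚ-mono-≤ : ∀ {t t′} k → 0ℚ ≤ t → t ≤ t′ → powℚ t k ≤ powℚ t′ k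
powℚ-mono-≤ zero    0≤t t≤t′ = ≤-refl
powℚ-mono-≤ (suc k) 0≤t t≤t′ = ≤-trans (*-monoʳ-≤-0≤ (powℚ-nonNeg k 0≤t) t≤t′)
  (*-monoˡ-≤-0≤ (≤-trans 0≤t t≤t′) (powℚ-mono-≤ k 0≤t t≤t′))

powℚ-inverse : ∀ {a b} k → a * b ≡ 1ℚ → powℚ a k * powℚ b k ≡ 1ℚ
powℚ-inverse zero    ab≡1 = refl
powℚ-inverse {a} {b} (suc k) ab≡1 = begin
  a * powℚ a k * (b * powℚ b k)      ≡⟨ interchange a (powℚ a k) b (powℚ b k) ⟩
  a * b * (powℚ a k * powℚ b k)      ≡⟨ cong₂ _*_ ab≡1 (powℚ-inverse k ab≡1) ⟩
  1ℚ                                 ∎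
  where open ≡-Reasoning

powℚ-suc-difference : ∀ {t t′} k → 0ℚ ≤ t → t ≤ t′ →
  powℚ t′ (suc k) - powℚ t (suc k) ≤ fromℕ (suc k) * (t′ - t) * powℚ t′ k
powℚ-suc-difference {t} {t′} zero 0≤t t≤t′ = ≤-reflexive (linear t t′)
  where
  linear : ∀ t t′ → t′ * 1ℚ - t * 1ℚ ≡ (1ℚ + 0ℚ) * (t′ - t) * 1ℚ
  linear = solve-∀ ℚ-ring
powℚ-suc-difference {t} {t′} (suc k) 0≤t t≤t′ = begin
  t′ * P - t * Q                         ≡⟨ split t t′ P Q ⟩
  t′ * (P - Q) + Q * (t′ - t)            ≤⟨ +-mono-≤ (*-monoˡ-≤-0≤ 0≤t′ (powℚ-suc-difference k 0≤t t≤t′))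
                                                    (*-monoʳ-≤-0≤ (p≤q⇒0≤q-p t≤t′) (powℚ-mono-≤ (suc k) 0≤t t≤t′)) ⟩
  t′ * (n * (t′ - t) * R) + t′ * R * (t′ - t) ≡⟨ merge t t′ R n ⟩
  (1ℚ + n) * (t′ - t) * (t′ * R)         ∎
  where
  open ≤-Reasoning
  P = powℚ t′ (suc k)
  Q = powℚ t (suc k)
  R = powℚ t′ k
  n = fromℕ (suc k)
  0≤t′ = ≤-trans 0≤t t≤t′
  split : ∀ t t′ P Q → t′ * P - t * Q ≡ t′ * (P - Q) + Q * (t′ - t)
  split = solve-∀ ℚ-ring
  merge : ∀ t t′ R n → t′ * (n * (t′ - t) * R) + t′ * R * (t′ - t) ≡ (1ℚ + n) * (t′ - t) * (t′ * R)
  merge = solve-∀ ℚ-ring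

∑< : ℕ → (ℕ → ℚ) → ℚ
∑< zero    f = 0ℚ
∑< (suc m) f = ∑< m f + f m

syntax ∑< m (λ i → e) = ∑[ i < m ] e

∑<-cong : ∀ m {f g} → (∀ {i} → i N.< m → f i ≡ g i) → ∑< m f ≡ ∑< m g
∑<-cong zero    f≡g = refl
∑<-cong (suc m) f≡g = cong₂ _+_ (∑<-cong m (λ i<m → f≡g (ℕₚ.m<n⇒m<1+n i<m))) (f≡g ℕₚ.≤-refl)

-- Online algorithms on items larger than ½

Loads : ℕ → Set
Loads n = Fin n → ℚ

addToBin : ∀ {n} → Loads n → Fin n → ℚ → Loads n
addToBin load i x j = if does (j ≟ i) then load j + x else load j

emptyBins : ∀ {n} → Loads n → ℕ
emptyBins load = count (ℚₚ._≟ 0ℚ) (tabulate load)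

emptyBins-empty : ∀ n → emptyBins {n} (λ _ → 0ℚ) ≡ n
emptyBins-empty zero    = refl
emptyBins-empty (suc n) = cong suc (emptyBins-empty n)

emptyBins-addToBin : ∀ {n} (load : Loads n) i {x} → load i ≡ 0ℚ → x ≢ 0ℚ →
  emptyBins load ≡ suc (emptyBins (addToBin load i x))
emptyBins-addToBin {suc n} load zero {x} loadᵢ≡0 x≢0
  rewrite loadᵢ≡0 | +-identityˡ x | dec-false (x ℚₚ.≟ 0ℚ) x≢0 = refl
emptyBins-addToBin {suc n} load (suc i) loadᵢ≡0 x≢0
  with does (load zero ℚₚ.≟ 0ℚ) | emptyBins-addToBin (load ∘ suc) i loadᵢ≡0 x≢0
... | true  | eq = cong suc eq
... | false | eq = eq

EmptyOrOverHalf : ∀ {n} → Loads n → Set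
EmptyOrOverHalf load = ∀ i → load i ≡ 0ℚ ⊎ ½ < load i

fits : ∀ {n} → Loads n → Fin n → ℚ → Bool
fits load i x = (load i + x) ≤ᵇ 1ℚ

place : ∀ {n} → Loads n → Maybe (Fin n) → ℚ → Loads n
place load nothing  x = load
place load (just i) x = if fits load i x then addToBin load i x else load

gain : ∀ {n} → Loads n → Maybe (Fin n) → ℚ → ℚ
gain load nothing  x = 0ℚ
gain load (just i) x = if fits load i x then x else 0ℚ

fits⇒empty : ∀ {n} {load : Loads n} {i x} → EmptyOrOverHalf load → ½ < x → T (fits load i x) → load i ≡ 0ℚ
fits⇒empty {load = load} {i} {x} inv ½<x fit with inv i
... | inj₁ loadᵢ≡0 = loadᵢ≡0
... | inj₂ ½<loadᵢ = ⊥-elim (<-irrefl refl (<-≤-trans (+-mono-< ½<loadᵢ ½<x) (≤ᵇ⇒≤ fit)))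

addToBin-preserves : ∀ {n} {load : Loads n} {i x} → EmptyOrOverHalf load → ½ < x → load i ≡ 0ℚ →
  EmptyOrOverHalf (addToBin load i x)
addToBin-preserves {load = load} {i} {x} inv ½<x loadᵢ≡0 j with j ≟ i
... | yes refl = inj₂ (subst (½ <_) (sym (trans (cong (_+ x) loadᵢ≡0) (+-identityˡ x))) ½<x)
... | no _     = inv j

place-preserves : ∀ {n} {load : Loads n} d {x} → EmptyOrOverHalf load → ½ < x → EmptyOrOverHalf (place load d x)
place-preserves nothing inv ½<x = inv
place-preserves {load = load} (just i) {x} inv ½<x with fits load i x in fit
... | true  = addToBin-preserves inv ½<x (fits⇒empty inv ½<x (subst T (sym fit) tt))
... | false = inv

gain-place : ∀ {n} {load : Loads n} d {x} → EmptyOrOverHalf load → ½ < x →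
  gain load d x + fromℕ (emptyBins (place load d x)) * x ≡ fromℕ (emptyBins load) * x
gain-place nothing {x} inv ½<x = +-identityˡ _
gain-place {load = load} (just i) {x} inv ½<x with fits load i x in fit
... | false = +-identityˡ _
... | true  = begin
  x + e′ * x                        ≡⟨ sym ([1+p]*q≡q+p*q e′ x) ⟩
  fromℕ (suc (emptyBins load′)) * x  ≡⟨ cong (λ e → fromℕ e * x) (sym empties) ⟩
  fromℕ (emptyBins load) * x         ∎
  where
  open ≡-Reasoning
  load′ = addToBin load i x
  e′ = fromℕ (emptyBins load′)
  empties = emptyBins-addToBin load i (fits⇒empty inv ½<x (subst T (sym fit) tt)) (pos⇒≢0 (<-trans 0<½ ½<x))

module _ {n : ℕ} (A : Algorithm n) where

  runFrom-∷ : ∀ hist load x xs → runFrom A hist load (x ∷ xs) ≡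
    gain load (A hist x) x + runFrom A (hist ∷ʳ x) (place load (A hist x) x) xs
  runFrom-∷ hist load x xs with A hist x
  ... | nothing = sym (+-identityˡ _)
  ... | just i with fits load i x
  ...   | true  = refl
  ...   | false = sym (+-identityˡ _)

  loadsAfter : List ℚ → Loads n → List ℚ → Loads n
  loadsAfter hist load []       = load
  loadsAfter hist load (x ∷ xs) = loadsAfter (hist ∷ʳ x) (place load (A hist x) x) xs

  runFrom-++ : ∀ hist load xs ys →
    runFrom A hist load (xs ++ ys) ≡ runFrom A hist load xs + runFrom A (hist ++ xs) (loadsAfter hist load xs) ys
  runFrom-++ hist load []       ys =
    sym (trans (+-identityˡ _) (cong (λ h → runFrom A h load ys) (++-identityʳ hist)))
  runFrom-++ hist load (x ∷ xs) ys = begin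
    runFrom A hist load (x ∷ xs ++ ys)                 ≡⟨ runFrom-∷ hist load x (xs ++ ys) ⟩
    g + runFrom A (hist ∷ʳ x) load′ (xs ++ ys)         ≡⟨ cong (g +_) (runFrom-++ (hist ∷ʳ x) load′ xs ys) ⟩
    g + (runFrom A (hist ∷ʳ x) load′ xs + rest)        ≡⟨ sym (+-assoc g _ rest) ⟩
    g + runFrom A (hist ∷ʳ x) load′ xs + rest          ≡⟨ cong (_+ rest) (sym (runFrom-∷ hist load x xs)) ⟩
    runFrom A hist load (x ∷ xs) + rest                ≡⟨ cong (λ h → runFrom A hist load (x ∷ xs) + runFrom A h loads ys)
                                                                (∷ʳ-++ hist x xs) ⟩
    runFrom A hist load (x ∷ xs) + runFrom A (hist ++ x ∷ xs) loads ys ∎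
    where
    open ≡-Reasoning
    g     = gain load (A hist x) x
    load′ = place load (A hist x) x
    loads = loadsAfter hist load (x ∷ xs)
    rest  = runFrom A ((hist ∷ʳ x) ++ xs) loads ys

  loadsAfter-++ : ∀ hist load xs ys →
    loadsAfter hist load (xs ++ ys) ≡ loadsAfter (hist ++ xs) (loadsAfter hist load xs) ys
  loadsAfter-++ hist load []       ys = cong (λ h → loadsAfter h load ys) (sym (++-identityʳ hist))
  loadsAfter-++ hist load (x ∷ xs) ys = trans (loadsAfter-++ (hist ∷ʳ x) (place load (A hist x) x) xs ys)
    (cong (λ h → loadsAfter h (loadsAfter hist load (x ∷ xs)) ys) (∷ʳ-++ hist x xs))

  loadsAfter-preserves : ∀ hist {load} xs → All (½ <_) xs → EmptyOrOverHalf load →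
    EmptyOrOverHalf (loadsAfter hist load xs)
  loadsAfter-preserves hist []       []           inv = inv
  loadsAfter-preserves hist (x ∷ xs) (½<x ∷ ½<xs) inv =
    loadsAfter-preserves (hist ∷ʳ x) xs ½<xs (place-preserves (A hist x) inv ½<x)

  runFrom-replicate : ∀ hist {load} k {x} → ½ < x → EmptyOrOverHalf load →
    runFrom A hist load (replicate k x) + fromℕ (emptyBins (loadsAfter hist load (replicate k x))) * x
      ≡ fromℕ (emptyBins load) * x
  runFrom-replicate hist zero    ½<x inv = +-identityˡ _
  runFrom-replicate hist {load} (suc k) {x} ½<x inv = begin
    runFrom A hist load (x ∷ replicate k x) + E * x     ≡⟨ cong (_+ E * x) (runFrom-∷ hist load x (replicate k x)) ⟩
    g + runFrom A (hist ∷ʳ x) load′ (replicate k x) + E * x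
      ≡⟨ +-assoc g _ (E * x) ⟩
    g + (runFrom A (hist ∷ʳ x) load′ (replicate k x) + E * x)
      ≡⟨ cong (g +_) (runFrom-replicate (hist ∷ʳ x) k ½<x (place-preserves (A hist x) inv ½<x)) ⟩
    g + fromℕ (emptyBins load′) * x                     ≡⟨ gain-place (A hist x) inv ½<x ⟩
    fromℕ (emptyBins load) * x                          ∎
    where
    open ≡-Reasoning
    g     = gain load (A hist x) x
    load′ = place load (A hist x) x
    E     = fromℕ (emptyBins (loadsAfter (hist ∷ʳ x) load′ (replicate k x)))

  loadsOf : List ℚ → Loads n
  loadsOf σ = loadsAfter [] (λ _ → 0ℚ) σ

  loadsOf-replicate-preserves : ∀ σ k {x} → ½ < x → EmptyOrOverHalf (loadsOf σ) →
    EmptyOrOverHalf (loadsOf (σ ++ replicate k x))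
  loadsOf-replicate-preserves σ k ½<x inv = subst EmptyOrOverHalf (sym (loadsAfter-++ [] _ σ (replicate k _)))
    (loadsAfter-preserves σ (replicate k _) (replicate⁺ k ½<x) inv)

  potential : ℚ → List ℚ → ℚ
  potential c σ = fromℕ (emptyBins (loadsOf σ)) + run A σ * c

  potential-replicate : ∀ σ k {x c} → ½ < x → x * c ≡ 1ℚ → EmptyOrOverHalf (loadsOf σ) →
    potential c (σ ++ replicate k x) ≡ potential c σ
  potential-replicate σ k {x} {c} ½<x xc≡1 inv = trans split (sym conserved)
    where
    conservation : ∀ {e e′ g Δ x c : ℚ} → x * c ≡ 1ℚ → Δ + e′ * x ≡ e * x →
      e + g * c ≡ e′ + (g + Δ) * c
    conservation {e} {e′} {g} {Δ} {x} {c} xc≡1 balance = begin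
      e + g * c                     ≡⟨ cong (_+ g * c) (sym (trans (cong (e *_) xc≡1) (*-identityʳ e))) ⟩
      e * (x * c) + g * c           ≡⟨ cong (_+ g * c) (sym (*-assoc e x c)) ⟩
      e * x * c + g * c             ≡⟨ cong (λ u → u * c + g * c) (sym balance) ⟩
      (Δ + e′ * x) * c + g * c      ≡⟨ regroup Δ e′ x c g ⟩
      e′ * (x * c) + (g + Δ) * c    ≡⟨ cong (λ u → e′ * u + (g + Δ) * c) xc≡1 ⟩
      e′ * 1ℚ + (g + Δ) * c         ≡⟨ cong (_+ (g + Δ) * c) (*-identityʳ e′) ⟩
      e′ + (g + Δ) * c              ∎
      where
      open ≡-Reasoning
      regroup : ∀ Δ e′ x c g → (Δ + e′ * x) * c + g * c ≡ e′ * (x * c) + (g + Δ) * c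
      regroup = solve-∀ ℚ-ring
    split : potential c (σ ++ replicate k x) ≡ fromℕ (emptyBins (loadsAfter σ (loadsOf σ) (replicate k x)))
                                               + (run A σ + runFrom A σ (loadsOf σ) (replicate k x)) * c
    split = cong₂ (λ l g → fromℕ (emptyBins l) + g * c)
      (loadsAfter-++ [] (λ _ → 0ℚ) σ (replicate k x)) (runFrom-++ [] (λ _ → 0ℚ) σ (replicate k x))
    conserved : potential c σ ≡ fromℕ (emptyBins (loadsAfter σ (loadsOf σ) (replicate k x)))
                                + (run A σ + runFrom A σ (loadsOf σ) (replicate k x)) * c
    conserved = conservation {fromℕ (emptyBins (loadsOf σ))}
      {fromℕ (emptyBins (loadsAfter σ (loadsOf σ) (replicate k x)))} {run A σ}
      {runFrom A σ (loadsOf σ) (replicate k x)} xc≡1 (runFrom-replicate σ k ½<x inv)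

skip : ∀ {n} σ {τ} → Packing n τ → Packing n (σ ++ τ)
skip []      p = p
skip (x ∷ σ) p = nothing ∷ skip σ p

binLoad-skip : ∀ {n} σ {τ} (p : Packing n τ) i → binLoad (σ ++ τ) (skip σ p) i ≡ binLoad τ p i
binLoad-skip []      p i = refl
binLoad-skip (x ∷ σ) p i = binLoad-skip σ p i

packedValue-skip : ∀ {n} σ {τ} (p : Packing n τ) → packedValue (σ ++ τ) (skip σ p) ≡ packedValue τ p
packedValue-skip []      p = refl
packedValue-skip (x ∷ σ) p = packedValue-skip σ p

shift : ∀ {n k} → Vec (Maybe (Fin n)) k → Vec (Maybe (Fin (suc n))) k
shift = map (Maybe.map suc)

binLoad-shift-zero : ∀ {n} σ (p : Packing n σ) → binLoad {suc n} σ (shift p) zero ≡ 0ℚ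
binLoad-shift-zero []      []           = refl
binLoad-shift-zero (x ∷ σ) (nothing ∷ p) = binLoad-shift-zero σ p
binLoad-shift-zero (x ∷ σ) (just j ∷ p)  = trans (+-identityˡ _) (binLoad-shift-zero σ p)

binLoad-shift-suc : ∀ {n} σ (p : Packing n σ) i → binLoad {suc n} σ (shift p) (suc i) ≡ binLoad σ p i
binLoad-shift-suc []      []            i = refl
binLoad-shift-suc (x ∷ σ) (nothing ∷ p) i = binLoad-shift-suc σ p i
binLoad-shift-suc (x ∷ σ) (just j ∷ p)  i = cong ((if does (j ≟ i) then x else 0ℚ) +_) (binLoad-shift-suc σ p i)

packedValue-shift : ∀ {n} σ (p : Packing n σ) → packedValue {suc n} σ (shift p) ≡ packedValue σ p
packedValue-shift []      []            = refl
packedValue-shift (x ∷ σ) (nothing ∷ p) = packedValue-shift σ p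
packedValue-shift (x ∷ σ) (just j ∷ p)  = cong (x +_) (packedValue-shift σ p)

onePerBin : ∀ n x → Packing n (replicate n x)
onePerBin zero    x = []
onePerBin (suc n) x = just zero ∷ shift (onePerBin n x)

binLoad-onePerBin : ∀ n x i → binLoad (replicate n x) (onePerBin n x) i ≡ x
binLoad-onePerBin (suc n) x zero    =
  trans (cong (x +_) (binLoad-shift-zero (replicate n x) (onePerBin n x))) (+-identityʳ x)
binLoad-onePerBin (suc n) x (suc i) =
  trans (+-identityˡ _) (trans (binLoad-shift-suc (replicate n x) (onePerBin n x) i) (binLoad-onePerBin n x i))

packedValue-onePerBin : ∀ n x → packedValue (replicate n x) (onePerBin n x) ≡ fromℕ n * x
packedValue-onePerBin zero    x = sym (*-zeroˡ x)
packedValue-onePerBin (suc n) x = begin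
  x + packedValue {suc n} (replicate n x) (shift (onePerBin n x))
    ≡⟨ cong (x +_) (packedValue-shift (replicate n x) (onePerBin n x)) ⟩
  x + packedValue (replicate n x) (onePerBin n x)
    ≡⟨ cong (x +_) (packedValue-onePerBin n x) ⟩
  x + fromℕ n * x
    ≡⟨ sym ([1+p]*q≡q+p*q (fromℕ n) x) ⟩
  fromℕ (suc n) * x
    ∎
  where open ≡-Reasoning

competitive-replicate : ∀ {n} (A : Algorithm n) α → IsCompetitive α A →
  ∀ σ {x} → ValidInput σ → 0ℚ < x → x ≤ 1ℚ → α * fromℕ n * x ≤ run A (σ ++ replicate n x)
competitive-replicate {n} A α competitive σ {x} valid 0<x x≤1 = begin
  α * fromℕ n * x                                   ≡⟨ *-assoc α (fromℕ n) x ⟩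
  α * (fromℕ n * x)                                 ≡⟨ cong (α *_) (sym value) ⟩
  α * packedValue (σ ++ replicate n x) packing      ≤⟨ competitive (σ ++ replicate n x)
                                                         (++⁺ valid (replicate⁺ n (0<x , x≤1))) packing feasible ⟩
  run A (σ ++ replicate n x)                        ∎
  where
  open ≤-Reasoning
  packing = skip σ (onePerBin n x)
  value : packedValue (σ ++ replicate n x) packing ≡ fromℕ n * x
  value = trans (packedValue-skip σ (onePerBin n x)) (packedValue-onePerBin n x)
  feasible : Feasible (σ ++ replicate n x) packing
  feasible i = subst (_≤ 1ℚ) (sym (trans (binLoad-skip σ (onePerBin n x) i) (binLoad-onePerBin n x i))) x≤1

-- The adversary

relativeDrops : (ℕ → ℚ) → ℕ → ℚ
relativeDrops y m = ∑[ i < m ] (1ℚ - y (suc i) * recip (y i))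

telescope-base : ∀ {a y c g e : ℚ} → y * c ≡ 1ℚ → 0ℚ ≤ c → 0ℚ ≤ e → a * y ≤ g → a * (1ℚ + 0ℚ) ≤ e + g * c
telescope-base {a} {y} {c} {g} {e} yc≡1 0≤c 0≤e ay≤g = begin
  a * 1ℚ           ≡⟨ cong (a *_) (sym yc≡1) ⟩
  a * (y * c)      ≡⟨ sym (*-assoc a y c) ⟩
  a * y * c        ≤⟨ *-monoʳ-≤-0≤ 0≤c ay≤g ⟩
  g * c            ≡⟨ sym (+-identityˡ (g * c)) ⟩
  0ℚ + g * c       ≤⟨ +-monoˡ-≤ (g * c) 0≤e ⟩
  e + g * c        ∎
  where open ≤-Reasoning

telescope-step : ∀ {a y c c′ g e H : ℚ} → y * c′ ≡ 1ℚ → c ≤ c′ → a * y ≤ g → a * (1ℚ + H) ≤ e + g * c →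
  a * (1ℚ + (H + (1ℚ - y * c))) ≤ e + g * c′
telescope-step {a} {y} {c} {c′} {g} {e} {H} yc′≡1 c≤c′ ay≤g ih = begin
  a * (1ℚ + (H + (1ℚ - y * c)))          ≡⟨ cong (λ u → a * (1ℚ + (H + (u - y * c)))) (sym yc′≡1) ⟩
  a * (1ℚ + (H + (y * c′ - y * c)))      ≡⟨ split a H y c c′ ⟩
  a * (1ℚ + H) + a * y * (c′ - c)        ≤⟨ +-mono-≤ ih (*-monoʳ-≤-0≤ (p≤q⇒0≤q-p c≤c′) ay≤g) ⟩
  e + g * c + g * (c′ - c)               ≡⟨ merge e g c c′ ⟩
  e + g * c′                             ∎
  where
  open ≤-Reasoning
  split : ∀ a H y c c′ → a * (1ℚ + (H + (y * c′ - y * c))) ≡ a * (1ℚ + H) + a * y * (c′ - c)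
  split = solve-∀ ℚ-ring
  merge : ∀ e g c c′ → e + g * c + g * (c′ - c) ≡ e + g * c′
  merge = solve-∀ ℚ-ring

module _ {n : ℕ} (A : Algorithm n) (α : ℚ) (competitive : IsCompetitive α A) (y : ℕ → ℚ) {m : ℕ}
  (½<y : ∀ {j} → j N.≤ m → ½ < y j) (y≤1 : ∀ {j} → j N.≤ m → y j ≤ 1ℚ)
  (y-antitone : ∀ {j} → j N.< m → y (suc j) ≤ y j) where

  private
    0<y : ∀ {j} → j N.≤ m → 0ℚ < y j
    0<y j≤m = <-trans 0<½ (½<y j≤m)

    y*recip-y : ∀ {j} → j N.≤ m → y j * recip (y j) ≡ 1ℚ
    y*recip-y j≤m = *-recip (pos⇒≢0 (0<y j≤m))

  -- From σ the adversary plays n items of size y j, then n of size y (j − 1), …, then n of size y 0.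
  potential-bound : ∀ j → j N.≤ m → ∀ σ → ValidInput σ → EmptyOrOverHalf (loadsOf A σ) →
    α * fromℕ n * (1ℚ + relativeDrops y j) ≤ potential A (recip (y j)) σ
  potential-bound zero j≤m σ valid inv =
    subst (α * fromℕ n * (1ℚ + 0ℚ) ≤_) (potential-replicate A σ n (½<y j≤m) (y*recip-y j≤m) inv)
      (telescope-base {α * fromℕ n} {y 0} {recip (y 0)} {run A σ′} {fromℕ (emptyBins (loadsOf A σ′))}
        (y*recip-y j≤m) (<⇒≤ (recip-pos (0<y j≤m))) (fromℕ-nonNeg (emptyBins (loadsOf A σ′)))
        (competitive-replicate A α competitive σ valid (0<y j≤m) (y≤1 j≤m)))
    where σ′ = σ ++ replicate n (y 0)
  potential-bound (suc i) j≤m σ valid inv =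
    subst (α * fromℕ n * (1ℚ + relativeDrops y (suc i)) ≤_) (potential-replicate A σ n (½<y j≤m) (y*recip-y j≤m) inv)
      (telescope-step {α * fromℕ n} {y (suc i)} {recip (y i)} {recip (y (suc i))} {run A σ′}
                      {fromℕ (emptyBins (loadsOf A σ′))} {relativeDrops y i}
        (y*recip-y j≤m) (recip-antitone (0<y j≤m) (y-antitone j≤m))
        (competitive-replicate A α competitive σ valid (0<y j≤m) (y≤1 j≤m))
        (potential-bound i (ℕₚ.<⇒≤ j≤m) σ′
          (++⁺ valid (replicate⁺ n (0<y j≤m , y≤1 j≤m)))
          (loadsOf-replicate-preserves A σ n (½<y j≤m) inv)))
    where σ′ = σ ++ replicate n (y (suc i))

ratio-bound : ∀ {n} (A : Algorithm (suc n)) α → IsCompetitive α A → (y : ℕ → ℚ) {m : ℕ} →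
  (∀ {j} → j N.≤ m → ½ < y j) → (∀ {j} → j N.≤ m → y j ≤ 1ℚ) → (∀ {j} → j N.< m → y (suc j) ≤ y j) →
  α * (1ℚ + relativeDrops y m) ≤ 1ℚ
ratio-bound {n} A α competitive y {m} ½<y y≤1 y-antitone =
  *-cancelˡ-≤-pos (fromℕ (suc n)) {{positive (fromℕ-pos n)}} (begin
    n′ * (α * (1ℚ + D))
      ≡⟨ x∙yz≈y∙xz n′ α (1ℚ + D) ⟩
    α * (n′ * (1ℚ + D))
      ≡⟨ sym (*-assoc α n′ (1ℚ + D)) ⟩
    α * n′ * (1ℚ + D)
      ≤⟨ potential-bound A α competitive y ½<y y≤1 y-antitone m ℕₚ.≤-refl [] [] (λ _ → inj₁ refl) ⟩
    fromℕ (emptyBins {suc n} (λ _ → 0ℚ)) + 0ℚ * recip (y m)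
      ≡⟨ cong₂ _+_ (cong fromℕ (emptyBins-empty (suc n))) (*-zeroˡ (recip (y m))) ⟩
    n′ + 0ℚ
      ≡⟨ trans (+-identityʳ n′) (sym (*-identityʳ n′)) ⟩
    n′ * 1ℚ
      ∎)
  where
  open ≤-Reasoning
  n′ = fromℕ (suc n)
  D  = relativeDrops y m

ratio-bound-mono : ∀ {α p q} → α * (1ℚ + q) ≤ 1ℚ → 0ℚ ≤ p → p ≤ q → α * (1ℚ + p) ≤ 1ℚ
ratio-bound-mono {α} {p} {q} bound 0≤p p≤q with ≤-total 0ℚ α
... | inj₁ 0≤α = ≤-trans (*-monoˡ-≤-0≤ 0≤α (+-monoʳ-≤ 1ℚ p≤q)) bound
... | inj₂ α≤0 = ≤-trans (subst (α * (1ℚ + p) ≤_) (*-zeroˡ (1ℚ + p)) (*-monoʳ-≤-0≤ 0≤1+p α≤0)) 0≤1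
  where
  0≤1 : 0ℚ ≤ 1ℚ
  0≤1 = <⇒≤ (positive⁻¹ 1ℚ)
  0≤1+p : 0ℚ ≤ 1ℚ + p
  0≤1+p = +-mono-≤ 0≤1 0≤p

-- Approximating ln 2

-- The K-th partial sum of − ln (1 − t) = Σ_{k ≥ 1} t ^ k / k.
logSeries : ℕ → ℚ → ℚ
logSeries zero    t = 0ℚ
logSeries (suc k) t = logSeries k t + 1/suc k * powℚ t (suc k)

lnTwoApprox≡logSeries-½ : ∀ N → lnTwoApprox N ≡ logSeries N ½
lnTwoApprox≡logSeries-½ zero    = refl
lnTwoApprox≡logSeries-½ (suc N) = cong (_+ 1/suc N * powℚ ½ (suc N)) (lnTwoApprox≡logSeries-½ N)

logSeries-nonNeg : ∀ K {t} → 0ℚ ≤ t → 0ℚ ≤ logSeries K t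
logSeries-nonNeg zero    0≤t = ≤-refl
logSeries-nonNeg (suc K) 0≤t =
  +-mono-≤ (logSeries-nonNeg K 0≤t) (0≤*0≤⇒0≤* (1/suc-nonNeg K) (powℚ-nonNeg (suc K) 0≤t))

lnTwoApprox-nonNeg : ∀ N → 0ℚ ≤ lnTwoApprox N
lnTwoApprox-nonNeg N = subst (0ℚ ≤_) (sym (lnTwoApprox≡logSeries-½ N)) (logSeries-nonNeg N (<⇒≤ 0<½))

logSeries-0 : ∀ K → logSeries K 0ℚ ≡ 0ℚ
logSeries-0 zero    = refl
logSeries-0 (suc K) = cong₂ _+_ (logSeries-0 K)
  (trans (cong (1/suc K *_) (*-zeroˡ (powℚ 0ℚ K))) (*-zeroʳ (1/suc K)))

-- The discrete form of (d/dt) logSeries K t = (1 − t ^ K) / (1 − t).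
logSeries-increment-bound : ∀ K {t t′} → 0ℚ ≤ t → t ≤ t′ → t′ ≤ 1ℚ →
  (1ℚ - t′) * (logSeries K t′ - logSeries K t) ≤ (t′ - t) * (1ℚ - powℚ t′ K)
logSeries-increment-bound zero {t} {t′} _ _ _ = ≤-reflexive (constant t t′)
  where
  constant : ∀ t t′ → (1ℚ - t′) * (0ℚ - 0ℚ) ≡ (t′ - t) * (1ℚ - 1ℚ)
  constant = solve-∀ ℚ-ring
logSeries-increment-bound (suc K) {t} {t′} 0≤t t≤t′ t′≤1 = begin
  (1ℚ - t′) * ((F′ + w * P) - (F + w * Q))
    ≡⟨ split t′ F′ F w P Q ⟩
  (1ℚ - t′) * (F′ - F) + (1ℚ - t′) * (w * (P - Q))
    ≤⟨ +-mono-≤ (logSeries-increment-bound K 0≤t t≤t′ t′≤1)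
                (*-monoˡ-≤-0≤ (p≤q⇒0≤q-p t′≤1) (*-monoˡ-≤-0≤ (1/suc-nonNeg K) (powℚ-suc-difference K 0≤t t≤t′))) ⟩
  (t′ - t) * (1ℚ - R) + (1ℚ - t′) * (w * (n * (t′ - t) * R))
    ≡⟨ cong (λ u → (t′ - t) * (1ℚ - R) + (1ℚ - t′) * u) (cancel w n (t′ - t) R (1/suc*fromℕ-suc K)) ⟩
  (t′ - t) * (1ℚ - R) + (1ℚ - t′) * ((t′ - t) * R)
    ≡⟨ merge t t′ R ⟩
  (t′ - t) * (1ℚ - t′ * R)
    ∎
  where
  open ≤-Reasoning
  F′ = logSeries K t′
  F  = logSeries K t
  w  = 1/suc K
  n  = fromℕ (suc K)
  P  = powℚ t′ (suc K)
  Q  = powℚ t (suc K)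
  R  = powℚ t′ K
  split : ∀ s a b w p q → (1ℚ - s) * ((a + w * p) - (b + w * q)) ≡ (1ℚ - s) * (a - b) + (1ℚ - s) * (w * (p - q))
  split = solve-∀ ℚ-ring
  regroup : ∀ w n d r → w * (n * d * r) ≡ w * n * (d * r)
  regroup = solve-∀ ℚ-ring
  cancel : ∀ w n d r → w * n ≡ 1ℚ → w * (n * d * r) ≡ d * r
  cancel w n d r wn≡1 = begin-equality
    w * (n * d * r)   ≡⟨ regroup w n d r ⟩
    w * n * (d * r)   ≡⟨ cong (_* (d * r)) wn≡1 ⟩
    1ℚ * (d * r)      ≡⟨ *-identityˡ (d * r) ⟩
    d * r             ∎
  merge : ∀ t t′ r → (t′ - t) * (1ℚ - r) + (1ℚ - t′) * ((t′ - t) * r) ≡ (t′ - t) * (1ℚ - t′ * r)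
  merge = solve-∀ ℚ-ring

logSeries-increment-≤ : ∀ K {t t′} → 0ℚ ≤ t → t ≤ t′ → t′ ≤ 1ℚ →
  (1ℚ - t′) * (logSeries K t′ - logSeries K t) ≤ t′ - t
logSeries-increment-≤ K {t} {t′} 0≤t t≤t′ t′≤1 = begin
  (1ℚ - t′) * (logSeries K t′ - logSeries K t) ≤⟨ logSeries-increment-bound K 0≤t t≤t′ t′≤1 ⟩
  (t′ - t) * (1ℚ - powℚ t′ K)                  ≤⟨ *-monoˡ-≤-0≤ (p≤q⇒0≤q-p t≤t′) 1-tᴷ≤1 ⟩
  (t′ - t) * 1ℚ                                ≡⟨ *-identityʳ (t′ - t) ⟩
  t′ - t                                       ∎
  where
  open ≤-Reasoning
  1-tᴷ≤1 : 1ℚ - powℚ t′ K ≤ 1ℚ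
  1-tᴷ≤1 = subst (1ℚ - powℚ t′ K ≤_) (+-identityʳ 1ℚ)
    (+-monoʳ-≤ 1ℚ (neg-antimono-≤ (powℚ-nonNeg K (≤-trans 0≤t t≤t′))))

logSeries-≤-∑ : ∀ K {h} j → 0ℚ ≤ h → fromℕ j * h < 1ℚ →
  logSeries K (fromℕ j * h) ≤ ∑[ i < suc j ] (h * recip (1ℚ - fromℕ i * h))
logSeries-≤-∑ K {h} zero 0≤h 0h<1 = begin
  logSeries K (0ℚ * h)   ≡⟨ trans (cong (logSeries K) (*-zeroˡ h)) (logSeries-0 K) ⟩
  0ℚ                     ≤⟨ +-mono-≤ ≤-refl (0≤*0≤⇒0≤* 0≤h (<⇒≤ (recip-pos (p<q⇒0<q-p 0h<1)))) ⟩
  0ℚ + h * recip (1ℚ - 0ℚ * h) ∎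
  where open ≤-Reasoning
logSeries-≤-∑ K {h} (suc i) 0≤h t′<1 = begin
  logSeries K t′                       ≡⟨ add-difference (logSeries K t′) (logSeries K t) ⟩
  logSeries K t + (logSeries K t′ - logSeries K t)
    ≤⟨ +-mono-≤ (logSeries-≤-∑ K i 0≤h (≤-<-trans t≤t′ t′<1)) increment≤ ⟩
  ∑[ k < suc i ] (h * recip (1ℚ - fromℕ k * h)) + h * recip (1ℚ - t′) ∎
  where
  open ≤-Reasoning
  t  = fromℕ i * h
  t′ = fromℕ (suc i) * h
  t≤t′ : t ≤ t′
  t≤t′ = *-monoʳ-≤-0≤ 0≤h (fromℕ-mono-≤ (ℕₚ.n≤1+n i))
  add-difference : ∀ a b → a ≡ b + (a - b)
  add-difference = solve-∀ ℚ-ring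
  step-length : ∀ a h → (1ℚ + a) * h - a * h ≡ h
  step-length = solve-∀ ℚ-ring
  increment≤ : logSeries K t′ - logSeries K t ≤ h * recip (1ℚ - t′)
  increment≤ = ≤-*-recip (p<q⇒0<q-p t′<1)
    (subst ((1ℚ - t′) * (logSeries K t′ - logSeries K t) ≤_) (step-length (fromℕ i) h)
      (logSeries-increment-≤ K (0≤*0≤⇒0≤* (fromℕ-nonNeg i) 0≤h) t≤t′ (<⇒≤ t′<1)))

spaced : ℚ → ℕ → ℚ
spaced h i = 1ℚ - fromℕ i * h

spaced-≤1 : ∀ {h} i → 0ℚ ≤ h → spaced h i ≤ 1ℚ
spaced-≤1 {h} i 0≤h = subst (spaced h i ≤_) (+-identityʳ 1ℚ)
  (+-monoʳ-≤ 1ℚ (neg-antimono-≤ (0≤*0≤⇒0≤* (fromℕ-nonNeg i) 0≤h)))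

spaced-antitone : ∀ {h} i → 0ℚ ≤ h → spaced h (suc i) ≤ spaced h i
spaced-antitone {h} i 0≤h =
  +-monoʳ-≤ 1ℚ (neg-antimono-≤ (*-monoʳ-≤-0≤ 0≤h (fromℕ-mono-≤ (ℕₚ.n≤1+n i))))

spaced->½ : ∀ {h m i} → 0ℚ ≤ h → fromℕ m * h < ½ → i N.≤ m → ½ < spaced h i
spaced->½ {h} 0≤h mh<½ i≤m =
  +-monoʳ-< 1ℚ (neg-antimono-< (≤-<-trans (*-monoʳ-≤-0≤ 0≤h (fromℕ-mono-≤ i≤m)) mh<½))

logSeries-≤-relativeDrops-spaced : ∀ K {h} b → 0ℚ ≤ h → fromℕ (suc b) * h < ½ →
  logSeries K (fromℕ b * h) ≤ relativeDrops (spaced h) (suc b)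
logSeries-≤-relativeDrops-spaced K {h} b 0≤h short = begin
  logSeries K (fromℕ b * h)                       ≤⟨ logSeries-≤-∑ K b 0≤h (<-trans bh<½ ½<1) ⟩
  ∑[ i < suc b ] (h * recip (spaced h i))        ≡⟨ ∑<-cong (suc b) (λ {i} i≤b →
                                                       sym (drop≡ {i} (spaced->½ 0≤h short (ℕₚ.<⇒≤ i≤b)))) ⟩
  relativeDrops (spaced h) (suc b)                ∎
  where
  open ≤-Reasoning
  bh<½ : fromℕ b * h < ½
  bh<½ = ≤-<-trans (*-monoʳ-≤-0≤ 0≤h (fromℕ-mono-≤ (ℕₚ.n≤1+n b))) short
  drop≡ : ∀ {i} → ½ < spaced h i → 1ℚ - spaced h (suc i) * recip (spaced h i) ≡ h * recip (spaced h i)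
  drop≡ {i} ½<y = begin-equality
    1ℚ - spaced h (suc i) * c                 ≡⟨ cong (_- spaced h (suc i) * c) (sym (*-recip (pos⇒≢0 (<-trans 0<½ ½<y)))) ⟩
    spaced h i * c - spaced h (suc i) * c     ≡⟨ difference (fromℕ i) h c ⟩
    h * c                                     ∎
    where
    c = recip (spaced h i)
    difference : ∀ a h c → (1ℚ - a * h) * c - (1ℚ - (1ℚ + a) * h) * c ≡ h * c
    difference = solve-∀ ℚ-ring

ratio-bound-spaced : ∀ {n} (A : Algorithm (suc n)) α → IsCompetitive α A → ∀ K {b h} →
  0ℚ ≤ h → fromℕ (suc b) * h < ½ → α * (1ℚ + logSeries K (fromℕ b * h)) ≤ 1ℚ
ratio-bound-spaced A α competitive K {b} {h} 0≤h short =
  ratio-bound-mono {α}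
    (ratio-bound A α competitive (spaced h) {suc b} (spaced->½ {h} {suc b} 0≤h short)
      (λ {j} _ → spaced-≤1 j 0≤h) (λ {j} _ → spaced-antitone j 0≤h))
    (logSeries-nonNeg K (0≤*0≤⇒0≤* (fromℕ-nonNeg b) 0≤h))
    (logSeries-≤-relativeDrops-spaced K b 0≤h short)

-- Lowering ½ to ½ − g loses at most 2 g, which the extra term (½ − g) ^ (N + 1) / (N + 1) makes up for.
logSeries-½-≤-logSeries-suc : ∀ N {g} → 0ℚ ≤ g → g ≤ ¼ →
  g + g ≤ 1/suc N * powℚ ¼ (suc N) →
  logSeries N ½ ≤ logSeries (suc N) (½ - g)
logSeries-½-≤-logSeries-suc N {g} 0≤g g≤¼ 2g≤tail = begin
  logSeries N ½                          ≡⟨ halves (logSeries N ½) (logSeries N τ) ⟩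
  logSeries N τ + (½ * D + ½ * D)        ≤⟨ +-monoʳ-≤ (logSeries N τ) (+-mono-≤ ½D≤g ½D≤g) ⟩
  logSeries N τ + (g + g)                ≤⟨ +-monoʳ-≤ (logSeries N τ) 2g≤tail ⟩
  logSeries N τ + w * powℚ ¼ (suc N)     ≤⟨ +-monoʳ-≤ (logSeries N τ)
                                               (*-monoˡ-≤-0≤ (1/suc-nonNeg N) (powℚ-mono-≤ (suc N) 0≤¼ ¼≤τ)) ⟩
  logSeries (suc N) τ                    ∎
  where
  open ≤-Reasoning
  τ = ½ - g
  w = 1/suc N
  D = logSeries N ½ - logSeries N τ
  0≤¼ : 0ℚ ≤ ¼
  0≤¼ = nonNegative⁻¹ ¼
  ¼≤τ : ¼ ≤ τ
  ¼≤τ = +-monoʳ-≤ ½ (neg-antimono-≤ g≤¼)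
  τ≤½ : τ ≤ ½
  τ≤½ = subst (τ ≤_) (+-identityʳ ½) (+-monoʳ-≤ ½ (neg-antimono-≤ 0≤g))
  ½D≤g : ½ * D ≤ g
  ½D≤g = subst (½ * D ≤_) (½-[½-g]≡g g) (logSeries-increment-≤ N (≤-trans 0≤¼ ¼≤τ) τ≤½ (<⇒≤ ½<1))
    where
    ½-[½-g]≡g : ∀ g → ½ - (½ - g) ≡ g
    ½-[½-g]≡g = solve-∀ ℚ-ring
  halves : ∀ a b → a ≡ b + (½ * (a - b) + ½ * (a - b))
  halves = solve-∀ ℚ-ring

tail-term-inverse : ∀ N → 1/suc N * powℚ ¼ (suc N) * fromℕ (suc N N.* 4 N.^ suc N) ≡ 1ℚ
tail-term-inverse N = begin
  w * q * fromℕ (suc N N.* 4 N.^ suc N)    ≡⟨ cong (w * q *_) (trans (fromℕ-* (suc N) (4 N.^ suc N))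
                                                                    (cong (n *_) (fromℕ-^ 4 (suc N)))) ⟩
  w * q * (n * p)                          ≡⟨ regroup w q n p ⟩
  w * n * (p * q)                          ≡⟨ cong₂ _*_ (1/suc*fromℕ-suc N) (powℚ-inverse (suc N) refl) ⟩
  1ℚ                                       ∎
  where
  open ≡-Reasoning
  w = 1/suc N
  n = fromℕ (suc N)
  p = powℚ (fromℕ 4) (suc N)
  q = powℚ ¼ (suc N)
  regroup : ∀ w q n p → w * q * (n * p) ≡ w * n * (p * q)
  regroup = solve-∀ ℚ-ring

recip-double-≤-tail-term : ∀ N {B} → 2 N.* (suc N N.* 4 N.^ suc N) N.≤ suc B →
  recip (fromℕ (suc B)) + recip (fromℕ (suc B)) ≤ 1/suc N * powℚ ¼ (suc N)
recip-double-≤-tail-term N {B} 2d≤B = begin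
  r + r                            ≡⟨ double r ⟩
  fromℕ 2 * r                      ≡⟨ cong (_* r) (sym G*2d≡2) ⟩
  G * fromℕ (2 N.* d) * r          ≤⟨ *-monoʳ-≤-0≤ (<⇒≤ (recip-pos (fromℕ-pos B)))
                                          (*-monoˡ-≤-0≤ 0≤G (fromℕ-mono-≤ 2d≤B)) ⟩
  G * fromℕ (suc B) * r            ≡⟨ *-assoc G (fromℕ (suc B)) r ⟩
  G * (fromℕ (suc B) * r)          ≡⟨ cong (G *_) (*-recip (pos⇒≢0 (fromℕ-pos B))) ⟩
  G * 1ℚ                           ≡⟨ *-identityʳ G ⟩
  G                                ∎
  where
  open ≤-Reasoning
  d = suc N N.* 4 N.^ suc N
  r = recip (fromℕ (suc B))
  G = 1/suc N * powℚ ¼ (suc N)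
  0≤G : 0ℚ ≤ G
  0≤G = 0≤*0≤⇒0≤* (1/suc-nonNeg N) (powℚ-nonNeg (suc N) (nonNegative⁻¹ ¼))
  double : ∀ r → r + r ≡ fromℕ 2 * r
  double = solve-∀ ℚ-ring
  G*2d≡2 : G * fromℕ (2 N.* d) ≡ fromℕ 2
  G*2d≡2 = begin-equality
    G * fromℕ (2 N.* d)              ≡⟨ cong (G *_) (fromℕ-* 2 d) ⟩
    G * (fromℕ 2 * fromℕ d)          ≡⟨ x∙yz≈y∙xz G (fromℕ 2) (fromℕ d) ⟩
    fromℕ 2 * (G * fromℕ d)          ≡⟨ cong (fromℕ 2 *_) (tail-term-inverse N) ⟩
    fromℕ 2 * 1ℚ                     ≡⟨ *-identityʳ (fromℕ 2) ⟩
    fromℕ 2                          ∎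

mesh : ℕ → ℚ
mesh b = ½ * recip (fromℕ (suc (suc b)))

mesh-pos : ∀ b → 0ℚ < mesh b
mesh-pos b = subst (_< mesh b) (*-zeroʳ ½) (*-monoʳ-<-pos ½ (recip-pos (fromℕ-pos (suc b))))

fromℕ-suc-suc*mesh : ∀ b → fromℕ (suc (suc b)) * mesh b ≡ ½
fromℕ-suc-suc*mesh b = begin
  fromℕ (suc (suc b)) * (½ * r)   ≡⟨ x∙yz≈y∙xz (fromℕ (suc (suc b))) ½ r ⟩
  ½ * (fromℕ (suc (suc b)) * r)   ≡⟨ cong (½ *_) (*-recip (pos⇒≢0 (fromℕ-pos (suc b)))) ⟩
  ½ * 1ℚ                          ≡⟨ *-identityʳ ½ ⟩
  ½                               ∎
  where
  open ≡-Reasoning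
  r = recip (fromℕ (suc (suc b)))

fromℕ-suc*mesh<½ : ∀ b → fromℕ (suc b) * mesh b < ½
fromℕ-suc*mesh<½ b = subst (_< ½) (one-step-back (fromℕ (suc b)) (mesh b) ½ (fromℕ-suc-suc*mesh b))
  (+-monoʳ-< ½ (neg-antimono-< (mesh-pos b)))
  where
  one-step-back : ∀ a h c → (1ℚ + a) * h ≡ c → c - h ≡ a * h
  one-step-back a h c eq = begin
    c - h                ≡⟨ cong (_- h) (sym eq) ⟩
    (1ℚ + a) * h - h     ≡⟨ [1+a]h-h≡ah a h ⟩
    a * h                ∎
    where
    open ≡-Reasoning
    [1+a]h-h≡ah : ∀ a h → (1ℚ + a) * h - h ≡ a * h
    [1+a]h-h≡ah = solve-∀ ℚ-ring

fromℕ*mesh≡½-recip : ∀ b → fromℕ b * mesh b ≡ ½ - recip (fromℕ (suc (suc b)))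
fromℕ*mesh≡½-recip b = begin
  fromℕ b * mesh b                               ≡⟨ two-steps-back (fromℕ b) r ⟩
  fromℕ (suc (suc b)) * mesh b - r               ≡⟨ cong (_- r) (fromℕ-suc-suc*mesh b) ⟩
  ½ - r                                          ∎
  where
  open ≡-Reasoning
  r = recip (fromℕ (suc (suc b)))
  two-steps-back : ∀ a r → a * (½ * r) ≡ (1ℚ + (1ℚ + a)) * (½ * r) - r
  two-steps-back = solve-∀ ℚ-ring

-- steps N + 2 = 4 + 2 (N + 1) 4 ^ (N + 1) makes the gap ½ − steps N · mesh (steps N) = 1 / (steps N + 2)
-- at most half of the tail term ¼ ^ (N + 1) / (N + 1).
steps : ℕ → ℕ
steps N = 2 N.+ 2 N.* (suc N N.* 4 N.^ suc N)

lnTwoApprox-≤-logSeries : ∀ N → lnTwoApprox N ≤ logSeries (suc N) (fromℕ (steps N) * mesh (steps N))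
lnTwoApprox-≤-logSeries N = begin
  lnTwoApprox N                 ≡⟨ lnTwoApprox≡logSeries-½ N ⟩
  logSeries N ½                 ≤⟨ logSeries-½-≤-logSeries-suc N (<⇒≤ (recip-pos (fromℕ-pos (suc b)))) r≤¼
                                     (recip-double-≤-tail-term N (ℕₚ.m≤n+m (2 N.* d) 4)) ⟩
  logSeries (suc N) (½ - r)     ≡⟨ cong (logSeries (suc N)) (sym (fromℕ*mesh≡½-recip b)) ⟩
  logSeries (suc N) (fromℕ b * mesh b) ∎
  where
  open ≤-Reasoning
  d = suc N N.* 4 N.^ suc N
  b = steps N
  r = recip (fromℕ (suc (suc b)))
  r≤¼ : r ≤ ¼
  r≤¼ = recip-antitone (fromℕ-pos 3) (fromℕ-mono-≤ (ℕₚ.m≤m+n 4 (2 N.* d)))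

lemma26 : (n : ℕ) → 1 N.≤ n → (A : Algorithm n) → (α : ℚ) →
    IsCompetitive α A → (N : ℕ) → α * (1ℚ + lnTwoApprox N) ≤ 1ℚ
lemma26 (suc n) _ A α competitive N =
  ratio-bound-mono {α} (ratio-bound-spaced A α competitive (suc N) {b} (<⇒≤ (mesh-pos b)) (fromℕ-suc*mesh<½ b))
    (lnTwoApprox-nonNeg N) (lnTwoApprox-≤-logSeries N)
  where b = steps N
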